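{- Let $q$ be an odd prime power, let $1\le k<n$ be integers, and let $\Gamma^{\square}(n,k,q)$ be the graph defined in the context. Then for every integer $l > \left\lfloor \frac{n-1}{k}\right\rfloor$, the graph $\Gamma^{\square}(n,k,q)$ contains no clique of size $l$ (it is $K_l$-free).
   Context: Let $q$ be an odd prime power and $\lambda$ a nonsquare in $\mathbb{F}_q$. Let $\lambda\mathrm{dot}_n$ denote the quadratic space $(\mathbb{F}_q^n, Q)$ with $Q(\mathbf{x})=x_1^2+\cdots+x_{n-1}^2+\lambda x_n^2$, and let $\perp$ denote orthogonality with respect to the symmetric bilinear form associated with $Q$. A $\mathrm{dot}_k$-subspace is a $k$-dimensional subspace $W\subseteq\mathbb{F}_q^n$ such that $(W,Q|_W)$ is isometrically isomorphic to $(\mathbb{F}_q^k, x_1^2+\cdots+x_k^2)$. The graph $\Gamma^{\square}(n,k,q)$ has as vertex set the set of $\mathrm{dot}_k$-subspaces of $\lambda\mathrm{dot}_n$, with two vertices $x,y$ adjacent if and only if $x\subseteq y^{\perp}$. $\lfloor t\rfloor$ denotes the largest integer $\le t$. -}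

module Defs where

open import Level using (0ℓ)
open import Data.Nat as ℕ using (ℕ; zero; suc)
open import Data.Nat.Primality using (Prime)
open import Data.Fin using (Fin; toℕ)
open import Data.Vec using (Vec; []; _∷_; lookup; foldr; zipWith; map; replicate; tabulate)
open import Data.Product using (Σ; ∃; ∃-syntax; _×_; _,_)
open import Function.Bundles using (_↔_)
open import Relation.Nullary using (¬_; yes; no)
open import Relation.Binary.PropositionalEquality using (_≡_; _≢_)
open import Algebra.Structures using (IsCommutativeRing)

OddPrimePower : ℕ → Set
OddPrimePower q = ∃[ p ] ∃[ e ] (Prime p × p ≢ 2 × 1 ℕ.≤ e × q ≡ p ℕ.^ e)

record FiniteField (q : ℕ) : Set₁ where
  infixl 6 _+_
  infixl 7 _*_
  field
    Carrier : Set
    _+_ _*_ : Carrier → Carrier → Carrier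
    -_      : Carrier → Carrier
    0# 1#   : Carrier
    isCommutativeRing : IsCommutativeRing _≡_ _+_ _*_ -_ 0# 1#
    0≢1     : 0# ≢ 1#
    inverse : ∀ x → x ≢ 0# → ∃[ y ] (x * y ≡ 1#)
    enumeration : Fin q ↔ Carrier

  _-_ : Carrier → Carrier → Carrier
  x - y = x + (- y)

  NonSquare : Carrier → Set
  NonSquare a = ∀ y → y * y ≢ a

  V : ℕ → Set
  V m = Vec Carrier m

  Σ' : ∀ {m} → V m → Carrier
  Σ' = foldr _ _+_ 0#

  _⊕_ : ∀ {m} → V m → V m → V m
  _⊕_ = zipWith _+_

  _·_ : ∀ {m} → Carrier → V m → V m
  a · v = map (a *_) v

  𝟎 : ∀ {m} → V m
  𝟎 = replicate _ 0#

  dot : ∀ {m} → V m → Carrier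
  dot v = Σ' (map (λ x → x * x) v)

  -- coefficient of the form λdot_n : 1 for coordinates 1..n-1, λ for the last
  coef : ∀ {n} → Carrier → Fin n → Carrier
  coef {n} λ' i with suc (toℕ i) ℕ.≟ n
  ... | yes _ = λ'
  ... | no  _ = 1#

  Qλ : ∀ {n} → Carrier → V n → Carrier
  Qλ {n} λ' v = Σ' (tabulate (λ i → coef λ' i * (lookup v i * lookup v i)))

  Bλ : ∀ {n} → Carrier → V n → V n → Carrier
  Bλ λ' x y = (Qλ λ' (x ⊕ y) - Qλ λ' x) - Qλ λ' y

  record Subspace (n : ℕ) : Set₁ where
    field
      _∈W   : V n → Set
      zero∈ : 𝟎 ∈W
      +∈    : ∀ {x y} → x ∈W → y ∈W → (x ⊕ y) ∈W
      ·∈    : ∀ a {x} → x ∈W → (a · x) ∈W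
  open Subspace public

  _≐_ : ∀ {n} → Subspace n → Subspace n → Set
  W ≐ U = ∀ v → (_∈W W v → _∈W U v) × (_∈W U v → _∈W W v)

  IsDotSubspace : ∀ {n} → Carrier → (k : ℕ) → Subspace n → Set
  IsDotSubspace {n} λ' k W =
    Σ (V k → V n) λ f → ( (∀ x y → f (x ⊕ y) ≡ f x ⊕ f y)
           × (∀ a x → f (a · x) ≡ a · f x)
           × (∀ x y → f x ≡ f y → x ≡ y)
           × (∀ x → _∈W W (f x))
           × (∀ v → _∈W W v → ∃[ x ] (f x ≡ v))
           × (∀ x → Qλ λ' (f x) ≡ dot {k} x) )

  _⊆⊥_ : ∀ {n} → Carrier → Subspace n → Subspace n → Set
  _⊆⊥_ λ' W U = ∀ x y → _∈W W x → _∈W U y → Bλ λ' x y ≡ 0#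

  -- a clique of size l in Γ^□(n,k,q): l pairwise distinct vertices
  -- (dot_k-subspaces), pairwise adjacent.
  Clique : (λ' : Carrier) (n k l : ℕ) → Set₁
  Clique λ' n k l =
    Σ (Fin l → Subspace n) λ W →
        (∀ i → IsDotSubspace λ' k (W i))
      × (∀ i j → i ≢ j → ¬ (W i ≐ W j))
      × (∀ i j → i ≢ j → _⊆⊥_ λ' (W i) (W j))

-- A clique W₀,…,W_{l-1} comes with additive maps fᵢ : F^k → Wᵢ ⊆ λdot_n carrying
-- x₁² + ⋯ + x_k² to Q, whose images are pairwise orthogonal (the polar form of Q is
-- twice the diagonal bilinear form P, and 2 ≠ 0 because λ is a nonsquare).  Gluing the
-- fᵢ gives such a map dot_{lk} → λdot_n, and l > ⌊(n-1)/k⌋ means lk ≥ n.  No such map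
-- exists, by Witt cancellation on n = m + 1: a reflection moves the image of the first
-- basis vector e to c·e (c² = 1); images of vectors orthogonal to e are then orthogonal
-- to e, i.e. have first coordinate 0, and dropping it gives a map dot_{N-1} → λdot_{n-1}.
-- In dimension 1 the image of e would satisfy λc² = 1, making λ a square.
module Submission where

open import Defs
open import Level using (0ℓ)
open import Data.Nat using (ℕ; zero; suc; _≤_; _<_; _∸_; NonZero; s≤s)
import Data.Nat as ℕ
import Data.Nat.Properties as ℕ
open import Data.Nat.DivMod using (_/_; m*n/n≡m; /-monoˡ-≤)
open import Data.Fin as Fin using (Fin)
import Data.Fin.Properties as Fin
open import Data.Vec using (Vec; []; _∷_; head; tail; lookup; replicate; take; drop; tabulate)
open import Data.Vec.Properties using (take-zipWith; drop-zipWith; tabulate-cong)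
open import Data.Product using (Σ; ∃; _×_; _,_; proj₁; proj₂)
open import Data.Empty using (⊥)
open import Function using (_∘_)
open import Function.Bundles using (_↔_; Inverse)
open import Relation.Nullary using (¬_; yes; no; contradiction)
open import Relation.Nullary.Decidable using (map′)
open import Relation.Binary.Definitions using (DecidableEquality)
open import Relation.Binary.PropositionalEquality
open import Algebra.Bundles using (CommutativeRing)

Fin-injective⇒surjective : ∀ {n} (f : Fin n → Fin n) → (∀ i j → f i ≡ f j → i ≡ j) →
                           ∀ y → ∃ λ x → f x ≡ y
Fin-injective⇒surjective {suc n} f inj y with Fin.any? (λ x → f x Fin.≟ y)
... | yes hit = hit
... | no miss
  with Fin.pigeonhole (ℕ.n<1+n n) (λ x → Fin.punchOut {i = y} {j = f x} (λ e → miss (x , sym e)))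
... | i , j , i<j , same = contradiction (inj i j (Fin.punchOut-injective (avoid i) (avoid j) same)) (Fin.<⇒≢ i<j)
  where
  avoid : ∀ x → y ≢ f x
  avoid x e = miss (x , sym e)

finite-injective⇒surjective : ∀ {n} {A : Set} → Fin n ↔ A → (f : A → A) →
                              (∀ x y → f x ≡ f y → x ≡ y) → ∀ y → ∃ λ x → f x ≡ y
finite-injective⇒surjective enum f inj y =
  to x , trans (sym (strictlyInverseˡ (f (to x)))) (trans (cong to hit) (strictlyInverseˡ y))
  where
  open Inverse enum using (to; from; strictlyInverseˡ; strictlyInverseʳ)
  g : Fin _ → Fin _
  g = from ∘ f ∘ to
  g-injective : ∀ i j → g i ≡ g j → i ≡ j
  g-injective i j e = trans (sym (strictlyInverseʳ i))
    (trans (cong from (inj (to i) (to j) (trans (sym (strictlyInverseˡ _)) (trans (cong to e) (strictlyInverseˡ _)))))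
           (strictlyInverseʳ j))
  x : Fin _
  x = proj₁ (Fin-injective⇒surjective g g-injective (from y))
  hit : g x ≡ from y
  hit = proj₂ (Fin-injective⇒surjective g g-injective (from y))

quotient-bound : ∀ {m k l} .{{_ : NonZero k}} → m / k < l → m < l ℕ.* k
quotient-bound {m} {k} {l} m/k<l = ℕ.≰⇒> λ lk≤m →
  ℕ.<⇒≱ m/k<l (subst (_≤ m / k) (m*n/n≡m l k) (/-monoˡ-≤ k lk≤m))

module QuadraticForms {q : ℕ} (F : FiniteField q) where
  open FiniteField F

  C : Set
  C = Carrier

  ring : CommutativeRing 0ℓ 0ℓ
  ring = record { isCommutativeRing = isCommutativeRing }

  open CommutativeRing ring using (commutativeSemiring; +-assoc; *-comm; *-assoc;
    +-identityˡ; +-identityʳ; *-identityˡ; *-identityʳ; zeroˡ; zeroʳ; distribʳ;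
    -‿inverseˡ; -‿inverseʳ)
  open import Algebra.Properties.Ring (CommutativeRing.ring ring)
    using (-1*x≈-x; -‿distribˡ-*; -‿+-comm; +-cancelˡ; +-inverseˡ-unique; -‿involutive)
  open import Algebra.Solver.Ring.NaturalCoefficients.Default commutativeSemiring
  open ≡-Reasoning

  no-zero-divisors : ∀ {x y} → x * y ≡ 0# → x ≢ 0# → y ≡ 0#
  no-zero-divisors {x} {y} xy≡0 x≢0 = begin
    y             ≡⟨ sym (*-identityˡ y) ⟩
    1# * y        ≡⟨ cong (_* y) (sym xz≡1) ⟩
    (x * z) * y   ≡⟨ solve 3 (λ x y z → (x :* z) :* y := z :* (x :* y)) refl x y z ⟩
    z * (x * y)   ≡⟨ cong (z *_) xy≡0 ⟩
    z * 0#        ≡⟨ zeroʳ z ⟩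
    0#            ∎
    where
    z : C
    z = proj₁ (inverse x x≢0)
    xz≡1 : x * z ≡ 1#
    xz≡1 = proj₂ (inverse x x≢0)

  *-nonzero : ∀ {x y} → x ≢ 0# → y ≢ 0# → x * y ≢ 0#
  *-nonzero x≢0 y≢0 xy≡0 = y≢0 (no-zero-divisors xy≡0 x≢0)

  unit-cancel : ∀ {c y} → c * c ≡ 1# → c * y ≡ 0# → y ≡ 0#
  unit-cancel {c} {y} cc≡1 cy≡0 = begin
    y              ≡⟨ sym (*-identityˡ y) ⟩
    1# * y         ≡⟨ cong (_* y) (sym cc≡1) ⟩
    (c * c) * y    ≡⟨ *-assoc c c y ⟩
    c * (c * y)    ≡⟨ cong (c *_) cy≡0 ⟩
    c * 0#         ≡⟨ zeroʳ c ⟩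
    0#             ∎

  -- λ·c² = 1 makes λ a square, namely of c⁻¹.
  inverse-square : ∀ {a c} → a * (c * c) ≡ 1# → ∃ λ y → y * y ≡ a
  inverse-square {a} {c} acc≡1 = y , (begin
    y * y                       ≡⟨ sym (*-identityˡ _) ⟩
    1# * (y * y)                ≡⟨ cong (_* (y * y)) (sym acc≡1) ⟩
    (a * (c * c)) * (y * y)     ≡⟨ solve 3 (λ a c y → (a :* (c :* c)) :* (y :* y) := a :* ((c :* y) :* (c :* y))) refl a c y ⟩
    a * ((c * y) * (c * y))     ≡⟨ cong (λ t → a * (t * t)) cy≡1 ⟩
    a * (1# * 1#)               ≡⟨ trans (cong (a *_) (*-identityˡ 1#)) (*-identityʳ a) ⟩
    a                           ∎)
    where
    c≢0 : c ≢ 0#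
    c≢0 c≡0 = 0≢1 (begin
      0#              ≡⟨ sym (zeroʳ a) ⟩
      a * 0#          ≡⟨ cong (a *_) (sym (zeroˡ c)) ⟩
      a * (0# * c)    ≡⟨ cong (λ t → a * (t * c)) (sym c≡0) ⟩
      a * (c * c)     ≡⟨ acc≡1 ⟩
      1#              ∎)
    y : C
    y = proj₁ (inverse c c≢0)
    cy≡1 : c * y ≡ 1#
    cy≡1 = proj₂ (inverse c c≢0)

  -1*-1≡1 : (- 1#) * (- 1#) ≡ 1#
  -1*-1≡1 = trans (-1*x≈-x (- 1#)) (-‿involutive 1#)

  -- Equality in a finite field is decidable (compare the enumeration indices).
  _≟_ : DecidableEquality C
  x ≟ y = map′ from-injective (cong from) (from x Fin.≟ from y)
    where
    open Inverse enumeration using (to; from; strictlyInverseˡ)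
    from-injective : from x ≡ from y → x ≡ y
    from-injective e = trans (sym (strictlyInverseˡ x)) (trans (cong to e) (strictlyInverseˡ y))

  square-zero : ∀ {z} → z * z ≡ 0# → z ≡ 0#
  square-zero {z} zz≡0 with z ≟ 0#
  ... | yes z≡0 = z≡0
  ... | no  z≢0 = no-zero-divisors zz≡0 z≢0

  -- If 1 + 1 = 0 then squaring is injective, hence (by finiteness) surjective:
  -- so a field with a nonsquare has characteristic ≠ 2.
  nonsquare⇒two≢0 : ∀ {a} → NonSquare a → 1# + 1# ≢ 0#
  nonsquare⇒two≢0 {a} nonsquare two≡0 = nonsquare (proj₁ root) (proj₂ root)
    where
    double≡0 : ∀ y → y + y ≡ 0#
    double≡0 y = begin
      y + y           ≡⟨ solve 1 (λ y → y :+ y := (con 1 :+ con 1) :* y) refl y ⟩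
      (1# + 1#) * y   ≡⟨ cong (_* y) two≡0 ⟩
      0# * y          ≡⟨ zeroˡ y ⟩
      0#              ∎
    square-injective : ∀ x y → x * x ≡ y * y → x ≡ y
    square-injective x y xx≡yy =
      trans (+-inverseˡ-unique x y (square-zero sum²≡0)) (sym (+-inverseˡ-unique y y (double≡0 y)))
      where
      sum²≡0 : (x + y) * (x + y) ≡ 0#
      sum²≡0 = begin
        (x + y) * (x + y)                   ≡⟨ solve 2 (λ x y → (x :+ y) :* (x :+ y) := (x :* x :+ y :* y) :+ (x :* y :+ x :* y)) refl x y ⟩
        (x * x + y * y) + (x * y + x * y)   ≡⟨ cong₂ _+_ (cong (_+ y * y) xx≡yy) (double≡0 (x * y)) ⟩
        (y * y + y * y) + 0#                ≡⟨ cong (_+ 0#) (double≡0 (y * y)) ⟩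
        0# + 0#                             ≡⟨ +-identityʳ 0# ⟩
        0#                                  ∎
    root : ∃ λ y → y * y ≡ a
    root = finite-injective⇒surjective enumeration (λ y → y * y) square-injective a

  -- The all-ones vector: the diagonal of the sum-of-squares form dot_n.
  𝟙 : ∀ {n} → V n
  𝟙 = replicate _ 1#

  ⊕-identityʳ : ∀ {n} (x : V n) → x ⊕ 𝟎 ≡ x
  ⊕-identityʳ []      = refl
  ⊕-identityʳ (a ∷ x) = cong₂ _∷_ (+-identityʳ a) (⊕-identityʳ x)

  ⊕-interchange : ∀ {n} (w x y z : V n) → (w ⊕ x) ⊕ (y ⊕ z) ≡ (w ⊕ y) ⊕ (x ⊕ z)
  ⊕-interchange []      []      []      []      = refl
  ⊕-interchange (a ∷ w) (b ∷ x) (c ∷ y) (d ∷ z) = cong₂ _∷_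
    (solve 4 (λ a b c d → (a :+ b) :+ (c :+ d) := (a :+ c) :+ (b :+ d)) refl a b c d)
    (⊕-interchange w x y z)

  tail-⊕ : ∀ {n} (u v : V (suc n)) → tail (u ⊕ v) ≡ tail u ⊕ tail v
  tail-⊕ (a ∷ u) (b ∷ v) = refl

  ·-distribʳ : ∀ {n} s t (v : V n) → (s + t) · v ≡ (s · v) ⊕ (t · v)
  ·-distribʳ s t []      = refl
  ·-distribʳ s t (a ∷ v) = cong₂ _∷_ (distribʳ a s t) (·-distribʳ s t v)

  reflect-sum : ∀ {n} (w e : V n) k → w ⊕ ((- 1#) · (w ⊕ (k · e))) ≡ ((- 1#) * k) · e
  reflect-sum []      []      k = refl
  reflect-sum (a ∷ w) (b ∷ e) k = cong₂ _∷_ (begin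
    a + m * (a + k * b)       ≡⟨ solve 4 (λ a b k m → a :+ m :* (a :+ k :* b) := (m :* a :+ a) :+ (m :* k) :* b) refl a b k m ⟩
    (m * a + a) + (m * k) * b ≡⟨ cong (λ t → (t + a) + (m * k) * b) (-1*x≈-x a) ⟩
    (- a + a) + (m * k) * b   ≡⟨ cong (_+ (m * k) * b) (-‿inverseˡ a) ⟩
    0# + (m * k) * b          ≡⟨ +-identityˡ _ ⟩
    (m * k) * b               ∎) (reflect-sum w e k)
    where
    m : C
    m = - 1#

  -- The diagonal bilinear form P_d(x,y) = Σ dᵢxᵢyᵢ and its quadratic form Q_d.
  -- (Q is unrelated to the prime power q.)

  P : ∀ {n} → Vec C n → V n → V n → C
  P []      []      []      = 0#
  P (c ∷ d) (a ∷ x) (b ∷ y) = c * (a * b) + P d x y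

  Q : ∀ {n} → Vec C n → V n → C
  Q d x = P d x x

  P-sym : ∀ {n} (d : Vec C n) x y → P d x y ≡ P d y x
  P-sym []      []      []      = refl
  P-sym (c ∷ d) (a ∷ x) (b ∷ y) = cong₂ _+_ (cong (c *_) (*-comm a b)) (P-sym d x y)

  P-addˡ : ∀ {n} (d : Vec C n) x y z → P d (x ⊕ y) z ≡ P d x z + P d y z
  P-addˡ []      []      []       []      = sym (+-identityʳ 0#)
  P-addˡ (c ∷ d) (a ∷ x) (a' ∷ y) (b ∷ z) =
    trans (cong (c * ((a + a') * b) +_) (P-addˡ d x y z))
      (solve 6 (λ c a a' b X Y → c :* ((a :+ a') :* b) :+ (X :+ Y) := (c :* (a :* b) :+ X) :+ (c :* (a' :* b) :+ Y))
             refl c a a' b (P d x z) (P d y z))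

  P-addʳ : ∀ {n} (d : Vec C n) x y z → P d x (y ⊕ z) ≡ P d x y + P d x z
  P-addʳ d x y z = begin
    P d x (y ⊕ z)       ≡⟨ P-sym d x (y ⊕ z) ⟩
    P d (y ⊕ z) x       ≡⟨ P-addˡ d y z x ⟩
    P d y x + P d z x   ≡⟨ cong₂ _+_ (P-sym d y x) (P-sym d z x) ⟩
    P d x y + P d x z   ∎

  P-scaleʳ : ∀ {n} (d : Vec C n) x s y → P d x (s · y) ≡ s * P d x y
  P-scaleʳ []      []      s []      = sym (zeroʳ s)
  P-scaleʳ (c ∷ d) (a ∷ x) s (b ∷ y) =
    trans (cong (c * (a * (s * b)) +_) (P-scaleʳ d x s y))
      (solve 5 (λ c a s b X → c :* (a :* (s :* b)) :+ s :* X := s :* (c :* (a :* b) :+ X)) refl c a s b (P d x y))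

  P-scaleˡ : ∀ {n} (d : Vec C n) s x y → P d (s · x) y ≡ s * P d x y
  P-scaleˡ d s x y = trans (P-sym d (s · x) y) (trans (P-scaleʳ d y s x) (cong (s *_) (P-sym d y x)))

  P-zeroʳ : ∀ {n} (d : Vec C n) x → P d x 𝟎 ≡ 0#
  P-zeroʳ []      []      = refl
  P-zeroʳ (c ∷ d) (a ∷ x) = begin
    c * (a * 0#) + P d x 𝟎   ≡⟨ cong₂ _+_ (trans (cong (c *_) (zeroʳ a)) (zeroʳ c)) (P-zeroʳ d x) ⟩
    0# + 0#                  ≡⟨ +-identityʳ 0# ⟩
    0#                       ∎

  P-first : ∀ {n} c (d : Vec C n) (y : V (suc n)) → P (c ∷ d) y (1# ∷ 𝟎) ≡ c * head y
  P-first c d (a ∷ y) = begin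
    c * (a * 1#) + P d y 𝟎   ≡⟨ cong₂ (λ s t → c * s + t) (*-identityʳ a) (P-zeroʳ d y) ⟩
    c * a + 0#               ≡⟨ +-identityʳ _ ⟩
    c * a                    ∎

  Q-first : ∀ {n} (d : Vec C n) → Q (1# ∷ d) (1# ∷ 𝟎) ≡ 1#
  Q-first d = trans (P-first 1# d (1# ∷ 𝟎)) (*-identityˡ 1#)

  Q-tail : ∀ {n} c (d : Vec C n) (y : V (suc n)) → head y ≡ 0# → Q (c ∷ d) y ≡ Q d (tail y)
  Q-tail c d (a ∷ y) a≡0 = begin
    c * (a * a) + Q d y     ≡⟨ cong (λ t → c * (t * t) + Q d y) a≡0 ⟩
    c * (0# * 0#) + Q d y   ≡⟨ cong (_+ Q d y) (trans (cong (c *_) (zeroʳ 0#)) (zeroʳ c)) ⟩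
    0# + Q d y              ≡⟨ +-identityˡ _ ⟩
    Q d y                   ∎

  Q-add : ∀ {n} (d : Vec C n) x y → Q d (x ⊕ y) ≡ (Q d x + Q d y) + (P d x y + P d x y)
  Q-add d x y = begin
    P d (x ⊕ y) (x ⊕ y)                         ≡⟨ P-addˡ d x y (x ⊕ y) ⟩
    P d x (x ⊕ y) + P d y (x ⊕ y)               ≡⟨ cong₂ _+_ (P-addʳ d x x y) (P-addʳ d y x y) ⟩
    (P d x x + P d x y) + (P d y x + P d y y)   ≡⟨ cong (λ t → (P d x x + P d x y) + (t + P d y y)) (P-sym d y x) ⟩
    (P d x x + P d x y) + (P d x y + P d y y)   ≡⟨ solve 3 (λ A X B → (A :+ X) :+ (X :+ B) := (A :+ B) :+ (X :+ X)) refl (P d x x) (P d x y) (P d y y) ⟩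
    (Q d x + Q d y) + (P d x y + P d x y)       ∎

  Q-add-unit : ∀ {n} (d : Vec C n) x y k → k * k ≡ 1# →
               Q d (x ⊕ (k · y)) ≡ (Q d x + Q d y) + (k * P d x y + k * P d x y)
  Q-add-unit d x y k kk≡1 = begin
    Q d (x ⊕ (k · y))                                         ≡⟨ Q-add d x (k · y) ⟩
    (Q d x + Q d (k · y)) + (P d x (k · y) + P d x (k · y))   ≡⟨ cong₂ (λ a b → (Q d x + a) + (b + b)) Q-ky (P-scaleʳ d x k y) ⟩
    (Q d x + Q d y) + (k * P d x y + k * P d x y)             ∎
    where
    Q-ky : Q d (k · y) ≡ Q d y
    Q-ky = begin
      P d (k · y) (k · y)   ≡⟨ P-scaleˡ d k y (k · y) ⟩
      k * P d y (k · y)     ≡⟨ cong (k *_) (P-scaleʳ d y k y) ⟩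
      k * (k * Q d y)       ≡⟨ sym (*-assoc k k _) ⟩
      (k * k) * Q d y       ≡⟨ cong (_* Q d y) kk≡1 ⟩
      1# * Q d y            ≡⟨ *-identityˡ _ ⟩
      Q d y                 ∎

  parallelogram : ∀ {n} (d : Vec C n) x y →
                  Q d (x ⊕ (1# · y)) + Q d (x ⊕ ((- 1#) · y)) ≡ (Q d x + Q d y) + (Q d x + Q d y)
  parallelogram d x y = begin
    Q d (x ⊕ (1# · y)) + Q d (x ⊕ ((- 1#) · y))
      ≡⟨ cong₂ _+_ (Q-add-unit d x y 1# (*-identityˡ 1#)) (Q-add-unit d x y (- 1#) -1*-1≡1) ⟩
    (A + (1# * p + 1# * p)) + (A + (m * p + m * p))
      ≡⟨ solve 3 (λ A m p → (A :+ (con 1 :* p :+ con 1 :* p)) :+ (A :+ (m :* p :+ m :* p)) := (A :+ A) :+ (con 1 :+ m) :* (p :+ p)) refl A m p ⟩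
    (A + A) + (1# + m) * (p + p)
      ≡⟨ cong (λ t → (A + A) + t * (p + p)) (-‿inverseʳ 1#) ⟩
    (A + A) + 0# * (p + p)
      ≡⟨ trans (cong ((A + A) +_) (zeroˡ _)) (+-identityʳ _) ⟩
    A + A ∎
    where
    A : C
    A = Q d x + Q d y
    p : C
    p = P d x y
    m : C
    m = - 1#

  -- Additive maps carrying one diagonal quadratic form to another.
  record Isometry {a b} (d₁ : Vec C a) (d₂ : Vec C b) : Set where
    field
      fun       : V a → V b
      additive  : ∀ x y → fun (x ⊕ y) ≡ fun x ⊕ fun y
      isometric : ∀ x → Q d₂ (fun x) ≡ Q d₁ x
  open Isometry public

  _∘ᵢ_ : ∀ {a b c} {d₁ : Vec C a} {d₂ : Vec C b} {d₃ : Vec C c} →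
         Isometry d₂ d₃ → Isometry d₁ d₂ → Isometry d₁ d₃
  ψ ∘ᵢ φ = record
    { fun       = fun ψ ∘ fun φ
    ; additive  = λ x y → trans (cong (fun ψ) (additive φ x y)) (additive ψ _ _)
    ; isometric = λ x → trans (isometric ψ (fun φ x)) (isometric φ x)
    }

  -- Isometries preserve the polar form 2P (polarise Q(x + y)).
  polar-preserved : ∀ {a b} {d₁ : Vec C a} {d₂ : Vec C b} (φ : Isometry d₁ d₂) x y →
                    P d₂ (fun φ x) (fun φ y) + P d₂ (fun φ x) (fun φ y) ≡ P d₁ x y + P d₁ x y
  polar-preserved {d₁ = d₁} {d₂} φ x y = +-cancelˡ (Q d₁ x + Q d₁ y) _ _ (begin
    (Q d₁ x + Q d₁ y) + (P₂ + P₂)                           ≡⟨ cong₂ (λ s t → (s + t) + (P₂ + P₂)) (sym (isometric φ x)) (sym (isometric φ y)) ⟩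
    (Q d₂ (fun φ x) + Q d₂ (fun φ y)) + (P₂ + P₂)           ≡⟨ sym (Q-add d₂ (fun φ x) (fun φ y)) ⟩
    Q d₂ (fun φ x ⊕ fun φ y)                                ≡⟨ cong (Q d₂) (sym (additive φ x y)) ⟩
    Q d₂ (fun φ (x ⊕ y))                                    ≡⟨ isometric φ (x ⊕ y) ⟩
    Q d₁ (x ⊕ y)                                            ≡⟨ Q-add d₁ x y ⟩
    (Q d₁ x + Q d₁ y) + (P d₁ x y + P d₁ x y)               ∎)
    where
    P₂ : C
    P₂ = P d₂ (fun φ x) (fun φ y)

  -- The reflection τ_v(x) = x − (2P(x,v)/Q(v))·v in an anisotropic vector v.
  module Reflection {n} (d : Vec C n) (v : V n) (Qv≢0 : Q d v ≢ 0#) where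
    private
      i : C
      i = proj₁ (inverse (Q d v) Qv≢0)
      Qv*i≡1 : Q d v * i ≡ 1#
      Qv*i≡1 = proj₂ (inverse (Q d v) Qv≢0)

    coeff : V n → C
    coeff x = - ((P d x v + P d x v) * i)

    coeff-additive : ∀ x y → coeff (x ⊕ y) ≡ coeff x + coeff y
    coeff-additive x y = begin
      - ((P d (x ⊕ y) v + P d (x ⊕ y) v) * i)
        ≡⟨ cong (λ t → - ((t + t) * i)) (P-addˡ d x y v) ⟩
      - (((P d x v + P d y v) + (P d x v + P d y v)) * i)
        ≡⟨ cong -_ (solve 3 (λ X Y i → ((X :+ Y) :+ (X :+ Y)) :* i := (X :+ X) :* i :+ (Y :+ Y) :* i) refl (P d x v) (P d y v) i) ⟩
      - ((P d x v + P d x v) * i + (P d y v + P d y v) * i)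
        ≡⟨ sym (-‿+-comm _ _) ⟩
      coeff x + coeff y ∎

    coeff-spec : ∀ x → coeff x * Q d v ≡ - (P d x v + P d x v)
    coeff-spec x = begin
      - (b * i) * Q d v     ≡⟨ sym (-‿distribˡ-* (b * i) (Q d v)) ⟩
      - ((b * i) * Q d v)   ≡⟨ cong -_ (solve 3 (λ b i Q → (b :* i) :* Q := b :* (Q :* i)) refl b i (Q d v)) ⟩
      - (b * (Q d v * i))   ≡⟨ cong (λ t → - (b * t)) Qv*i≡1 ⟩
      - (b * 1#)            ≡⟨ cong -_ (*-identityʳ b) ⟩
      - b                   ∎
      where
      b : C
      b = P d x v + P d x v

    -- τ_v is additive and preserves Q: the cross term 2s·P(x,v) cancels s²·Q(v).
    τ : Isometry d d
    τ = record { fun = reflect ; additive = reflect-additive ; isometric = reflect-isometric }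
      where
      reflect : V n → V n
      reflect x = x ⊕ (coeff x · v)
      reflect-additive : ∀ x y → reflect (x ⊕ y) ≡ reflect x ⊕ reflect y
      reflect-additive x y = begin
        (x ⊕ y) ⊕ (coeff (x ⊕ y) · v)                  ≡⟨ cong (λ t → (x ⊕ y) ⊕ (t · v)) (coeff-additive x y) ⟩
        (x ⊕ y) ⊕ ((coeff x + coeff y) · v)            ≡⟨ cong ((x ⊕ y) ⊕_) (·-distribʳ (coeff x) (coeff y) v) ⟩
        (x ⊕ y) ⊕ ((coeff x · v) ⊕ (coeff y · v))      ≡⟨ ⊕-interchange x y _ _ ⟩
        reflect x ⊕ reflect y                          ∎
      reflect-isometric : ∀ x → Q d (reflect x) ≡ Q d x
      reflect-isometric x = begin
        Q d (x ⊕ (s · v))                                   ≡⟨ Q-add d x (s · v) ⟩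
        (Q d x + Q d (s · v)) + (P d x (s · v) + P d x (s · v))
          ≡⟨ cong₂ (λ a b → (Q d x + a) + (b + b)) (trans (P-scaleˡ d s v (s · v)) (cong (s *_) (P-scaleʳ d v s v))) (P-scaleʳ d x s v) ⟩
        (Q d x + s * (s * Q d v)) + (s * p + s * p)
          ≡⟨ solve 4 (λ A s Qv p → (A :+ s :* (s :* Qv)) :+ (s :* p :+ s :* p) := A :+ s :* (s :* Qv :+ (p :+ p))) refl (Q d x) s (Q d v) p ⟩
        Q d x + s * (s * Q d v + (p + p))                   ≡⟨ cong (λ t → Q d x + s * (t + (p + p))) (coeff-spec x) ⟩
        Q d x + s * (- (p + p) + (p + p))                   ≡⟨ cong (λ t → Q d x + s * t) (-‿inverseˡ (p + p)) ⟩
        Q d x + s * 0#                                      ≡⟨ trans (cong (Q d x +_) (zeroʳ s)) (+-identityʳ _) ⟩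
        Q d x                                               ∎
        where
        s : C
        s = coeff x
        p : C
        p = P d x v

    τ-moves : ∀ w → P d w v + P d w v ≡ Q d v → fun τ w ≡ w ⊕ ((- 1#) · v)
    τ-moves w 2p≡Qv = cong (λ t → w ⊕ ((- t) · v)) (trans (cong (_* i) 2p≡Qv) Qv*i≡1)

  reflect-onto : ∀ {n} (d : Vec C n) (e w : V n) → Q d w ≡ Q d e → ∀ k → k * k ≡ 1# →
                 Q d (w ⊕ (k · e)) ≢ 0# →
                 Σ (Isometry d d) λ ψ → Σ C λ c → c * c ≡ 1# × fun ψ w ≡ c · e
  reflect-onto d e w Qw≡Qe k kk≡1 Qv≢0 =
    τ , (- 1#) * k , cc≡1 , trans (τ-moves w 2P≡Qv) (reflect-sum w e k)
    where
    v : V _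
    v = w ⊕ (k · e)
    p : C
    p = P d w e
    open Reflection d v Qv≢0
    2P≡Qv : P d w v + P d w v ≡ Q d v
    2P≡Qv = begin
      P d w v + P d w v                   ≡⟨ cong (λ t → t + t) (trans (P-addʳ d w w (k · e)) (cong (Q d w +_) (P-scaleʳ d w k e))) ⟩
      (Q d w + k * p) + (Q d w + k * p)   ≡⟨ solve 2 (λ A x → (A :+ x) :+ (A :+ x) := (A :+ A) :+ (x :+ x)) refl (Q d w) (k * p) ⟩
      (Q d w + Q d w) + (k * p + k * p)   ≡⟨ cong (λ t → (Q d w + t) + (k * p + k * p)) Qw≡Qe ⟩
      (Q d w + Q d e) + (k * p + k * p)   ≡⟨ sym (Q-add-unit d w e k kk≡1) ⟩
      Q d v                               ∎
    cc≡1 : ((- 1#) * k) * ((- 1#) * k) ≡ 1#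
    cc≡1 = begin
      ((- 1#) * k) * ((- 1#) * k)   ≡⟨ solve 2 (λ m k → (m :* k) :* (m :* k) := (m :* m) :* (k :* k)) refl (- 1#) k ⟩
      ((- 1#) * (- 1#)) * (k * k)   ≡⟨ cong₂ _*_ -1*-1≡1 kk≡1 ⟩
      1# * 1#                       ≡⟨ *-identityˡ 1# ⟩
      1#                            ∎

  λdiag : C → (m : ℕ) → Vec C (suc m)
  λdiag λ' zero    = λ' ∷ []
  λdiag λ' (suc m) = 1# ∷ λdiag λ' m

  Q-𝟙-split : ∀ k {r} (xs : V (k ℕ.+ r)) → Q 𝟙 xs ≡ Q 𝟙 (take k xs) + Q 𝟙 (drop k xs)
  Q-𝟙-split zero    xs       = sym (+-identityˡ _)
  Q-𝟙-split (suc k) (x ∷ xs) = trans (cong (1# * (x * x) +_) (Q-𝟙-split k xs)) (sym (+-assoc _ _ _))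

  -- Gluing l isometries F^k → (F^n, Q_d) with pairwise orthogonal images into one
  -- isometry F^{lk} → (F^n, Q_d): the i-th block of coordinates goes through the i-th map.
  module Gluing {n} (d : Vec C n) (k : ℕ) where

    glued : ∀ l → (Fin l → V k → V n) → V (l ℕ.* k) → V n
    glued zero    g xs = 𝟎
    glued (suc l) g xs = g Fin.zero (take k xs) ⊕ glued l (g ∘ Fin.suc) (drop k xs)

    glued-additive : ∀ l (g : Fin l → V k → V n) → (∀ i x y → g i (x ⊕ y) ≡ g i x ⊕ g i y) →
                     ∀ xs ys → glued l g (xs ⊕ ys) ≡ glued l g xs ⊕ glued l g ys
    glued-additive zero    g g-add xs ys = sym (⊕-identityʳ 𝟎)
    glued-additive (suc l) g g-add xs ys = begin
      g₀ (take k (xs ⊕ ys)) ⊕ rest (drop k (xs ⊕ ys))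
        ≡⟨ cong₂ (λ a b → g₀ a ⊕ rest b) (take-zipWith _+_ xs ys) (drop-zipWith _+_ xs ys) ⟩
      g₀ (take k xs ⊕ take k ys) ⊕ rest (drop k xs ⊕ drop k ys)
        ≡⟨ cong₂ _⊕_ (g-add Fin.zero _ _) (glued-additive l (g ∘ Fin.suc) (g-add ∘ Fin.suc) _ _) ⟩
      (g₀ (take k xs) ⊕ g₀ (take k ys)) ⊕ (rest (drop k xs) ⊕ rest (drop k ys))
        ≡⟨ ⊕-interchange _ _ _ _ ⟩
      glued (suc l) g xs ⊕ glued (suc l) g ys ∎
      where
      g₀ : V k → V n
      g₀ = g Fin.zero
      rest : V (l ℕ.* k) → V n
      rest = glued l (g ∘ Fin.suc)

    glued-orthogonal : ∀ l (g : Fin l → V k → V n) (u : V n) → (∀ i y → P d u (g i y) ≡ 0#) →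
                       ∀ xs → P d u (glued l g xs) ≡ 0#
    glued-orthogonal zero    g u u⊥g xs = P-zeroʳ d u
    glued-orthogonal (suc l) g u u⊥g xs = begin
      P d u (g Fin.zero (take k xs) ⊕ glued l (g ∘ Fin.suc) (drop k xs))
        ≡⟨ P-addʳ d u _ _ ⟩
      P d u (g Fin.zero (take k xs)) + P d u (glued l (g ∘ Fin.suc) (drop k xs))
        ≡⟨ cong₂ _+_ (u⊥g Fin.zero _) (glued-orthogonal l (g ∘ Fin.suc) u (u⊥g ∘ Fin.suc) (drop k xs)) ⟩
      0# + 0#
        ≡⟨ +-identityʳ 0# ⟩
      0# ∎

    glued-isometric : ∀ l (g : Fin l → V k → V n) → (∀ i x → Q d (g i x) ≡ Q 𝟙 x) →
                      (∀ i j → i ≢ j → ∀ x y → P d (g i x) (g j y) ≡ 0#) →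
                      ∀ xs → Q d (glued l g xs) ≡ Q 𝟙 xs
    glued-isometric zero    g g-iso g-orth [] = P-zeroʳ d 𝟎
    glued-isometric (suc l) g g-iso g-orth xs = begin
      Q d (g₀ a ⊕ rest b)
        ≡⟨ Q-add d (g₀ a) (rest b) ⟩
      (Q d (g₀ a) + Q d (rest b)) + (P d (g₀ a) (rest b) + P d (g₀ a) (rest b))
        ≡⟨ cong₂ (λ s t → s + (t + t)) (cong₂ _+_ (g-iso Fin.zero a) rest-iso) first⊥rest ⟩
      (Q 𝟙 a + Q 𝟙 b) + (0# + 0#)
        ≡⟨ trans (cong ((Q 𝟙 a + Q 𝟙 b) +_) (+-identityʳ 0#)) (+-identityʳ _) ⟩
      Q 𝟙 a + Q 𝟙 b
        ≡⟨ sym (Q-𝟙-split k xs) ⟩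
      Q 𝟙 xs ∎
      where
      a : V k
      a = take k xs
      b : V (l ℕ.* k)
      b = drop k xs
      g₀ : V k → V n
      g₀ = g Fin.zero
      rest : V (l ℕ.* k) → V n
      rest = glued l (g ∘ Fin.suc)
      rest-iso : Q d (rest b) ≡ Q 𝟙 b
      rest-iso = glued-isometric l (g ∘ Fin.suc) (g-iso ∘ Fin.suc)
                   (λ i j i≢j → g-orth (Fin.suc i) (Fin.suc j) (i≢j ∘ Fin.suc-injective)) b
      first⊥rest : P d (g₀ a) (rest b) ≡ 0#
      first⊥rest = glued-orthogonal l (g ∘ Fin.suc) (g₀ a) (λ i → g-orth Fin.zero (Fin.suc i) (λ ()) a) b

    glue : ∀ l (g : Fin l → Isometry (𝟙 {k}) d) →
           (∀ i j → i ≢ j → ∀ x y → P d (fun (g i) x) (fun (g j) y) ≡ 0#) →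
           Isometry (𝟙 {l ℕ.* k}) d
    glue l g g-orth = record
      { fun       = glued l (fun ∘ g)
      ; additive  = glued-additive l (fun ∘ g) (additive ∘ g)
      ; isometric = glued-isometric l (fun ∘ g) (isometric ∘ g) g-orth
      }

  -- Shifting the index of coef by one keeps it: the λ sits at the last coordinate.
  coef-suc : ∀ λ' {n} (i : Fin n) → coef {suc n} λ' (Fin.suc i) ≡ coef {n} λ' i
  coef-suc λ' {n} i with suc (suc (Fin.toℕ i)) ℕ.≟ suc n | suc (Fin.toℕ i) ℕ.≟ n
  ... | yes _ | yes _ = refl
  ... | no  _ | no  _ = refl
  ... | yes p | no ¬p = contradiction (ℕ.suc-injective p) ¬p
  ... | no ¬p | yes p = contradiction (cong suc p) ¬p

  tabulate-coef : ∀ λ' m → tabulate (coef {suc m} λ') ≡ λdiag λ' m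
  tabulate-coef λ' zero    = refl
  tabulate-coef λ' (suc m) = cong (1# ∷_) (trans (tabulate-cong (coef-suc λ')) (tabulate-coef λ' m))

  Q-tabulate : ∀ {n} (g : Fin n → C) (v : V n) →
               Σ' (tabulate (λ i → g i * (lookup v i * lookup v i))) ≡ Q (tabulate g) v
  Q-tabulate g []      = refl
  Q-tabulate g (a ∷ v) = cong (g Fin.zero * (a * a) +_) (Q-tabulate (g ∘ Fin.suc) v)

  Qλ≡Q : ∀ λ' {m} (v : V (suc m)) → Qλ λ' v ≡ Q (λdiag λ' m) v
  Qλ≡Q λ' {m} v = trans (Q-tabulate (coef λ') v) (cong (λ d → Q d v) (tabulate-coef λ' m))

  dot≡Q𝟙 : ∀ {n} (x : V n) → dot x ≡ Q 𝟙 x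
  dot≡Q𝟙 []      = refl
  dot≡Q𝟙 (a ∷ x) = cong₂ _+_ (sym (*-identityˡ (a * a))) (dot≡Q𝟙 x)

  Bλ≡2P : ∀ λ' {m} (x y : V (suc m)) → Bλ λ' x y ≡ P (λdiag λ' m) x y + P (λdiag λ' m) x y
  Bλ≡2P λ' {m} x y = begin
    (Qλ λ' (x ⊕ y) - Qλ λ' x) - Qλ λ' y
      ≡⟨ cong₂ (λ s t → (s - t) - Qλ λ' y) (trans (Qλ≡Q λ' (x ⊕ y)) (Q-add d x y)) (Qλ≡Q λ' x) ⟩
    (((Q d x + Q d y) + T) + - Q d x) + - Qλ λ' y
      ≡⟨ cong (λ t → (((Q d x + Q d y) + T) + - Q d x) + - t) (Qλ≡Q λ' y) ⟩
    (((Q d x + Q d y) + T) + - Q d x) + - Q d y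
      ≡⟨ solve 5 (λ A B T nA nB → (((A :+ B) :+ T) :+ nA) :+ nB := T :+ ((A :+ nA) :+ (B :+ nB))) refl (Q d x) (Q d y) T (- Q d x) (- Q d y) ⟩
    T + ((Q d x + - Q d x) + (Q d y + - Q d y))
      ≡⟨ cong₂ (λ s t → T + (s + t)) (-‿inverseʳ (Q d x)) (-‿inverseʳ (Q d y)) ⟩
    T + (0# + 0#)
      ≡⟨ trans (cong (T +_) (+-identityʳ 0#)) (+-identityʳ T) ⟩
    T ∎
    where
    d : Vec C (suc m)
    d = λdiag λ' m
    T : C
    T = P d x y + P d x y

  parametrisation : ∀ {λ' m k} {W : Subspace (suc m)} → IsDotSubspace λ' k W → Isometry (𝟙 {k}) (λdiag λ' m)
  parametrisation {λ'} (f , f-additive , _ , _ , _ , _ , f-dot) = record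
    { fun       = f
    ; additive  = f-additive
    ; isometric = λ x → trans (sym (Qλ≡Q λ' (f x))) (trans (f-dot x) (dot≡Q𝟙 x))
    }

  parametrisation-into : ∀ {λ' m k} {W : Subspace (suc m)} (p : IsDotSubspace λ' k W) x →
                         _∈W W (fun (parametrisation {λ'} {m} {k} {W} p) x)
  parametrisation-into (_ , _ , _ , _ , f-into , _) = f-into

  module Witt (two≢0 : 1# + 1# ≢ 0#) where

    double-zero : ∀ {a} → a + a ≡ 0# → a ≡ 0#
    double-zero {a} 2a≡0 =
      no-zero-divisors (trans (solve 1 (λ a → (con 1 :+ con 1) :* a := a :+ a) refl a) 2a≡0) two≢0

    -- Alignment: if Q w = Q e ≠ 0, some reflection sends w to ±e, since
    -- Q(w + e) + Q(w − e) = 4 Q e ≠ 0 forces one of w ± e to be anisotropic.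
    align : ∀ {n} (d : Vec C n) (e w : V n) → Q d w ≡ Q d e → Q d e ≢ 0# →
            Σ (Isometry d d) λ ψ → Σ C λ c → c * c ≡ 1# × fun ψ w ≡ c · e
    align d e w Qw≡Qe Qe≢0 with Q d (w ⊕ ((- 1#) · e)) ≟ 0#
    ... | no  Q[w-e]≢0 = reflect-onto d e w Qw≡Qe (- 1#) -1*-1≡1 Q[w-e]≢0
    ... | yes Q[w-e]≡0 = reflect-onto d e w Qw≡Qe 1# (*-identityˡ 1#) Q[w+e]≢0
      where
      Q[w+e]≢0 : Q d (w ⊕ (1# · e)) ≢ 0#
      Q[w+e]≢0 Q[w+e]≡0 = *-nonzero two≢0 (*-nonzero two≢0 Qe≢0) (begin
        (1# + 1#) * ((1# + 1#) * Q d e)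
          ≡⟨ solve 1 (λ a → (con 1 :+ con 1) :* ((con 1 :+ con 1) :* a) := (a :+ a) :+ (a :+ a)) refl (Q d e) ⟩
        (Q d e + Q d e) + (Q d e + Q d e)
          ≡⟨ cong (λ t → (t + Q d e) + (t + Q d e)) (sym Qw≡Qe) ⟩
        (Q d w + Q d e) + (Q d w + Q d e)
          ≡⟨ sym (parallelogram d w e) ⟩
        Q d (w ⊕ (1# · e)) + Q d (w ⊕ ((- 1#) · e))
          ≡⟨ cong₂ _+_ Q[w+e]≡0 Q[w-e]≡0 ⟩
        0# + 0#
          ≡⟨ +-identityʳ 0# ⟩
        0# ∎)

    -- After aligning the image of e = (1,0,…,0) with ±e, vectors
    -- orthogonal to e map to vectors with first coordinate 0.
    cancel-first : ∀ {a b} {d₁ : Vec C a} {d₂ : Vec C b} →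
                   Isometry (1# ∷ d₁) (1# ∷ d₂) → Isometry d₁ d₂
    cancel-first {d₁ = d₁} {d₂} φ = record
      { fun       = restricted
      ; additive  = restricted-additive
      ; isometric = restricted-isometric
      }
      where
      e : ∀ {n} → V (suc n)
      e = 1# ∷ 𝟎
      aligned : Σ (Isometry (1# ∷ d₂) (1# ∷ d₂)) λ ψ → Σ C λ c → c * c ≡ 1# × fun ψ (fun φ e) ≡ c · e
      aligned = align (1# ∷ d₂) e (fun φ e) (trans (isometric φ e) (trans (Q-first d₁) (sym (Q-first d₂))))
                      (λ Qe≡0 → 0≢1 (trans (sym Qe≡0) (Q-first d₂)))
      χ : Isometry (1# ∷ d₁) (1# ∷ d₂)
      χ = proj₁ aligned ∘ᵢ φ
      c : C
      c = proj₁ (proj₂ aligned)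
      cc≡1 : c * c ≡ 1#
      cc≡1 = proj₁ (proj₂ (proj₂ aligned))
      χe≡ce : fun χ e ≡ c · e
      χe≡ce = proj₂ (proj₂ (proj₂ aligned))

      head-zero : ∀ x → head (fun χ (0# ∷ x)) ≡ 0#
      head-zero x = trans (sym (*-identityˡ _)) (unit-cancel cc≡1 (double-zero (begin
        c * (1# * h) + c * (1# * h)   ≡⟨ cong (λ t → t + t) (sym (trans (P-scaleʳ (1# ∷ d₂) y c e) (cong (c *_) (P-first 1# d₂ y)))) ⟩
        P (1# ∷ d₂) y (c · e) + P (1# ∷ d₂) y (c · e)
                                      ≡⟨ cong (λ t → P (1# ∷ d₂) y t + P (1# ∷ d₂) y t) (sym χe≡ce) ⟩
        P (1# ∷ d₂) y (fun χ e) + P (1# ∷ d₂) y (fun χ e)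
                                      ≡⟨ polar-preserved χ (0# ∷ x) e ⟩
        P (1# ∷ d₁) (0# ∷ x) e + P (1# ∷ d₁) (0# ∷ x) e
                                      ≡⟨ cong (λ t → t + t) (trans (P-first 1# d₁ (0# ∷ x)) (zeroʳ 1#)) ⟩
        0# + 0#                       ≡⟨ +-identityʳ 0# ⟩
        0#                            ∎)))
        where
        y : V (suc _)
        y = fun χ (0# ∷ x)
        h : C
        h = head y

      restricted : V _ → V _
      restricted x = tail (fun χ (0# ∷ x))

      restricted-additive : ∀ x y → restricted (x ⊕ y) ≡ restricted x ⊕ restricted y
      restricted-additive x y = begin
        tail (fun χ (0# ∷ (x ⊕ y)))                    ≡⟨ cong (λ t → tail (fun χ (t ∷ (x ⊕ y)))) (sym (+-identityʳ 0#)) ⟩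
        tail (fun χ ((0# ∷ x) ⊕ (0# ∷ y)))             ≡⟨ cong tail (additive χ (0# ∷ x) (0# ∷ y)) ⟩
        tail (fun χ (0# ∷ x) ⊕ fun χ (0# ∷ y))         ≡⟨ tail-⊕ (fun χ (0# ∷ x)) (fun χ (0# ∷ y)) ⟩
        restricted x ⊕ restricted y                    ∎

      restricted-isometric : ∀ x → Q d₂ (restricted x) ≡ Q d₁ x
      restricted-isometric x = begin
        Q d₂ (restricted x)              ≡⟨ sym (Q-tail 1# d₂ (fun χ (0# ∷ x)) (head-zero x)) ⟩
        Q (1# ∷ d₂) (fun χ (0# ∷ x))     ≡⟨ isometric χ (0# ∷ x) ⟩
        Q (1# ∷ d₁) (0# ∷ x)             ≡⟨ Q-tail 1# d₁ (0# ∷ x) refl ⟩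
        Q d₁ x                           ∎

    no-isometry : ∀ {λ'} → NonSquare λ' → ∀ m N → m < N → ¬ Isometry (𝟙 {N}) (λdiag λ' m)
    no-isometry {λ'} nonsquare zero (suc N) _ φ =
      base (fun φ (1# ∷ 𝟎)) (trans (isometric φ (1# ∷ 𝟎)) (Q-first (𝟙 {N})))
      where
      base : ∀ u → Q (λdiag λ' zero) u ≡ 1# → ⊥
      base (c ∷ []) Qu≡1 = nonsquare (proj₁ root) (proj₂ root)
        where
        root : ∃ λ y → y * y ≡ λ'
        root = inverse-square (trans (sym (+-identityʳ _)) Qu≡1)
    no-isometry nonsquare (suc m) (suc N) (s≤s m<N) φ = no-isometry nonsquare m N m<N (cancel-first φ)

    -- A clique of dot_k-subspaces glues to one isometry dot_{lk} → λdot_{m+1}: the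
    -- parametrisations are isometries, and adjacency (Bλ = 2P = 0) makes their images
    -- pairwise orthogonal.
    clique⇒isometry : ∀ {λ' m k l} → Clique λ' (suc m) k l → Isometry (𝟙 {l ℕ.* k}) (λdiag λ' m)
    clique⇒isometry {λ'} {m} {k} {l} (W , dotSubspace , _ , adjacent) =
      Gluing.glue (λdiag λ' m) k l f orthogonal
      where
      f : Fin l → Isometry 𝟙 (λdiag λ' m)
      f i = parametrisation {λ'} {m} {k} {W i} (dotSubspace i)
      into : ∀ i x → _∈W (W i) (fun (f i) x)
      into i = parametrisation-into {λ'} {m} {k} {W i} (dotSubspace i)
      orthogonal : ∀ i j → i ≢ j → ∀ x y → P (λdiag λ' m) (fun (f i) x) (fun (f j) y) ≡ 0#
      orthogonal i j i≢j x y = double-zero (trans (sym (Bλ≡2P λ' (fun (f i) x) (fun (f j) y)))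
        (adjacent i j i≢j _ _ (into i x) (into j y)))

-- Main theorem.
mainTheorem2 : (q : ℕ) → OddPrimePower q → (F : FiniteField q) →
    (λ' : FiniteField.Carrier F) → FiniteField.NonSquare F λ' →
    (n k : ℕ) → .{{_ : NonZero k}} → 1 ≤ k → k < n →
    (l : ℕ) → (n ∸ 1) / k < l →
    ¬ FiniteField.Clique F λ' n k l
mainTheorem2 q _ F λ' nonsquare zero    k _ () l _
mainTheorem2 q _ F λ' nonsquare (suc m) k _ _  l m/k<l clique =
  no-isometry nonsquare m (l ℕ.* k) (quotient-bound m/k<l) (clique⇒isometry clique)
  where
  open QuadraticForms F
  open Witt (nonsquare⇒two≢0 nonsquare)
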